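{- Let $f$ be a perfect coloring of $H(n,q)$ with quotient matrix $\begin{pmatrix} a & b\\ c& d\end{pmatrix}$. If there exists a $1$-perfect code in $H(q+1,q)$, then there exists a perfect $2q$-coloring $g$ of $H(qn,q)$ with quotient matrix $T=(t_{ij})_{i,j=1}^{2q}$, where $t_{ij}=a$ if $i,j\le q$; $t_{ij}=b$ if $i\le q<j$; $t_{ij}=c$ if $j\le q<i$; and $t_{ij}=d$ if $i,j>q$.
   Context: $H(n,q)$: vertex set $\mathbb{Z}_q^n$, two vertices adjacent iff they differ in exactly one coordinate. A perfect $k$-coloring is a surjective map from the vertices onto $\{1,\dots,k\}$ such that every vertex of color $i$ has exactly $s_{ij}$ neighbors of color $j$, for constants $s_{ij}$ forming the quotient matrix. A $1$-perfect code in $H(N,q)$ is a set $C$ of vertices such that every ball of radius $1$ (in Hamming distance) contains exactly one element of $C$. -}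

module Defs where

open import Data.Nat using (ℕ; zero; suc; _+_; _*_; _<ᵇ_; _≡ᵇ_; _≤ᵇ_)
open import Data.Bool using (Bool; true; false; if_then_else_; _∧_)
open import Data.Fin using (Fin; toℕ; _≟_)
open import Data.Vec using (Vec; []; _∷_)
open import Data.List using (List; []; _∷_; [_]; map; concatMap; allFin)
open import Data.Product using (Σ; ∃; _×_)
open import Relation.Nullary.Decidable using (⌊_⌋)
open import Relation.Binary.PropositionalEquality using (_≡_)

Vertex : ℕ → ℕ → Set
Vertex n q = Vec (Fin q) n

allVertices : (n q : ℕ) → List (Vertex n q)
allVertices zero    q = [ [] ]
allVertices (suc n) q = concatMap (λ x → map (x ∷_) (allVertices n q)) (allFin q)

dist : ∀ {n q} → Vertex n q → Vertex n q → ℕ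
dist []       []       = 0
dist (x ∷ xs) (y ∷ ys) = (if ⌊ x ≟ y ⌋ then 0 else 1) + dist xs ys

countB : ∀ {A : Set} → (A → Bool) → List A → ℕ
countB P []       = 0
countB P (x ∷ xs) = (if P x then 1 else 0) + countB P xs

adjacentᵇ : ∀ {n q} → Vertex n q → Vertex n q → Bool
adjacentᵇ v w = dist v w ≡ᵇ 1

nbrCount : ∀ {n q k} → (Vertex n q → Fin k) → Vertex n q → Fin k → ℕ
nbrCount {n} {q} f v j = countB (λ w → adjacentᵇ v w ∧ ⌊ f w ≟ j ⌋) (allVertices n q)

IsPerfectColoring : (n q k : ℕ) → (Vertex n q → Fin k) → (Fin k → Fin k → ℕ) → Set
IsPerfectColoring n q k f S =
  (∀ (j : Fin k) → ∃ λ (v : Vertex n q) → f v ≡ j)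
  × (∀ (v : Vertex n q) (j : Fin k) → nbrCount f v j ≡ S (f v) j)

IsOnePerfectCode : (N q : ℕ) → (Vertex N q → Bool) → Set
IsOnePerfectCode N q C =
  ∀ (x : Vertex N q) → countB (λ c → C c ∧ (dist x c ≤ᵇ 1)) (allVertices N q) ≡ 1

OnePerfectCodeExists : (N q : ℕ) → Set
OnePerfectCodeExists N q = Σ (Vertex N q → Bool) λ C → IsOnePerfectCode N q C

-- 2x2 quotient matrix ( a b ; c d ), rows/columns indexed by Fin 2 (0 ~ colour 1).
mat2 : ℕ → ℕ → ℕ → ℕ → Fin 2 → Fin 2 → ℕ
mat2 a b c d Fin.zero    Fin.zero    = a
mat2 a b c d Fin.zero    (Fin.suc _) = b
mat2 a b c d (Fin.suc _) Fin.zero    = c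
mat2 a b c d (Fin.suc _) (Fin.suc _) = d

blockT : (q : ℕ) → ℕ → ℕ → ℕ → ℕ → Fin (2 * q) → Fin (2 * q) → ℕ
blockT q a b c d i j with toℕ i <ᵇ q | toℕ j <ᵇ q
... | true  | true  = a
... | true  | false = b
... | false | true  = c
... | false | false = d

module Submission where

-- A 1-perfect code C in
-- H(q+1,q) is the graph of a map u ↦ (codeX u, codeY u) on Z_q^(q-1), and
--   φ (v ∷ u) = v + codeX u ,   ψ (v ∷ u) = codeY u
-- is a "local covering" H(q,q) → Z_q × Z_q: the neighbours of Y are sent
-- bijectively onto the pairs (a,b) with a ≠ φ Y.  Cutting a vertex of H(nk,q)
-- into n blocks of length k, applying φ blockwise (π) and adding up the ψ's
-- modulo q (σ) turns any local covering into a "covering": for every t, the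
-- neighbours W of X with σ W = t are sent by π bijectively onto the neighbours
-- of π X.  Pulling f back along a surjective covering gives the perfect
-- colouring X ↦ (f (π X), σ X) with the blown-up matrix (lifting lemma), which
-- for k = q is lemma8.  If n = 0 or q ≤ 1, H(n,q) has at most one vertex and
-- there is no perfect 2-colouring at all.

open import Defs
open import Data.Nat using (ℕ; zero; suc; _+_; _*_; _∸_; _≤_; _<_; z≤n; s≤s; _≡ᵇ_; _≤ᵇ_; _<ᵇ_; _%_)
open import Data.Nat.Properties hiding (_≟_)
open import Data.Nat.DivMod using (m%n<n; %-distribˡ-+; m%n%n≡m%n; [m+n]%n≡m%n; m<n⇒m%n≡m)
open import Algebra.Properties.CommutativeSemigroup +-commutativeSemigroup using (xy∙z≈xz∙y; x∙yz≈yx∙z)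
open import Algebra.Properties.Semiring.Sum +-*-semiring
  using (sum; sum-cong-≗; ∑-distrib-+; ∑-comm; *-distribˡ-sum; sum-replicate-zero)
open import Data.Bool using (Bool; true; false; if_then_else_; _∧_; not)
import Data.Bool.Properties as Boolₚ
open import Data.Fin using (Fin; zero; suc; toℕ; _≟_; fromℕ<; combine; remQuot)
import Data.Fin.Properties as Finₚ
open import Data.Vec using (Vec; []; _∷_; _++_; replicate; take; drop)
open import Data.Vec.Properties using (take++drop≡id)
open import Data.List as List using (List)
open import Data.Product using (Σ; ∃; ∃₂; _×_; _,_; proj₁; proj₂)
open import Data.Sum using (_⊎_; inj₁; inj₂)
open import Data.Empty using (⊥; ⊥-elim)
open import Relation.Nullary using (¬_; Dec; does; yes; no)
open import Relation.Nullary.Decidable using (⌊_⌋; isYes≗does; dec-true; dec-false)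
open import Function.Bundles using (Equivalence)
open import Relation.Binary.PropositionalEquality

ind : Bool → ℕ
ind b = if b then 1 else 0

infix 7 _==_

-- Boolean equality test on Fin q.  (Using 'does' rather than ⌊_⌋ makes
-- suc x == suc y compute to x == y.)
_==_ : ∀ {q} → Fin q → Fin q → Bool
x == y = does (x ≟ y)

==-refl : ∀ {q} (x : Fin q) → x == x ≡ true
==-refl x = dec-true (x ≟ x) refl

==-sound : ∀ {q} {x y : Fin q} → x == y ≡ true → x ≡ y
==-sound {x = x} {y} eq with x ≟ y
... | yes x≡y = x≡y
==-sound () | no _

==-false : ∀ {q} {x y : Fin q} → x ≢ y → x == y ≡ false
==-false {x = x} {y} = dec-false (x ≟ y)

==-sym : ∀ {q} (x y : Fin q) → x == y ≡ y == x
==-sym x y with x ≟ y | y ≟ x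
... | yes _   | yes _   = refl
... | no _    | no _    = refl
... | yes x≡y | no y≢x = ⊥-elim (y≢x (sym x≡y))
... | no x≢y  | yes y≡x = ⊥-elim (x≢y (sym y≡x))

ind-∧-* : ∀ b c → ind (b ∧ c) ≡ ind b * ind c
ind-∧-* true  c = sym (+-identityʳ (ind c))
ind-∧-* false c = refl

ind-∧-if : ∀ b c → ind (b ∧ c) ≡ (if b then ind c else 0)
ind-∧-if true  c = refl
ind-∧-if false c = refl

ind-∧-pos : ∀ b c → 0 < ind (b ∧ c) → b ≡ true × c ≡ true
ind-∧-pos true true _ = refl , refl

guard-* : ∀ b c n → (if b then 0 else c * n) ≡ c * (if b then 0 else n)
guard-* true  c n = sym (*-zeroʳ c)
guard-* false c n = refl

guard-≤ : ∀ b {m n} → m ≤ n → (if b then 0 else m) ≤ (if b then 0 else n)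
guard-≤ true  _   = z≤n
guard-≤ false m≤n = m≤n

guard-zero : ∀ b {n} → n ≡ 0 → (if b then 0 else n) ≡ 0
guard-zero true  _   = refl
guard-zero false n≡0 = n≡0

guard-pos : ∀ b {n} → 0 < (if b then 0 else n) → 0 < n
guard-pos false pos = pos

guard-ind : ∀ b c → (if b then 0 else ind c) ≡ ind (not b ∧ c)
guard-ind true  c = refl
guard-ind false c = refl

guard-swap : ∀ b c n → (if b then 0 else (if c then n else 0)) ≡ (if c then (if b then 0 else n) else 0)
guard-swap true  true  n = refl
guard-swap true  false n = refl
guard-swap false c     n = refl

guard-split : ∀ b m n → (if b then m else n) ≡ (if b then m else 0) + (if b then 0 else n)
guard-split true  m n = sym (+-identityʳ m)
guard-split false m n = refl

guard-∧ : ∀ b c n → n * ind (b ∧ c) ≡ (if b then (if c then n else 0) else 0)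
guard-∧ true  true  n = *-identityʳ n
guard-∧ true  false n = *-zeroʳ n
guard-∧ false c     n = *-zeroʳ n

mask : ∀ b n → n * ind (not b) ≡ (if b then 0 else n)
mask true  n = *-zeroʳ n
mask false n = *-identityʳ n

sum-zero : ∀ {q} {h : Fin q → ℕ} → (∀ x → h x ≡ 0) → sum h ≡ 0
sum-zero {q} h≡0 = trans (sum-cong-≗ h≡0) (sum-replicate-zero q)

sum-const : ∀ {q} c → sum {q} (λ _ → c) ≡ q * c
sum-const {zero}  c = refl
sum-const {suc q} c = cong (c +_) (sum-const {q} c)

sum-mono : ∀ {q} {h k : Fin q → ℕ} → (∀ x → h x ≤ k x) → sum h ≤ sum k
sum-mono {zero}  h≤k = z≤n
sum-mono {suc q} h≤k = +-mono-≤ (h≤k zero) (sum-mono (λ x → h≤k (suc x)))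

term≤sum : ∀ {q} (e : Fin q) (h : Fin q → ℕ) → h e ≤ sum h
term≤sum zero    h = m≤m+n (h zero) _
term≤sum (suc e) h = ≤-trans (term≤sum e (λ x → h (suc x))) (m≤n+m _ (h zero))

+-pos : ∀ m n → 0 < m + n → 0 < m ⊎ 0 < n
+-pos zero    n pos = inj₂ pos
+-pos (suc m) n _   = inj₁ (s≤s z≤n)

sum-pos : ∀ {q} (h : Fin q → ℕ) → 0 < sum h → ∃ λ x → 0 < h x
sum-pos {suc q} h pos with +-pos (h zero) _ pos
... | inj₁ pos₀ = zero , pos₀
... | inj₂ pos₁ with sum-pos (λ x → h (suc x)) pos₁
...   | x , posₓ = suc x , posₓ

sum-guard : ∀ {q} b (k : Fin q → ℕ) → sum (λ y → if b then 0 else k y) ≡ (if b then 0 else sum k)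
sum-guard {q} true k = sum-replicate-zero q
sum-guard     false k = refl

sum-if : ∀ {q} b (k : Fin q → ℕ) → sum (λ y → if b then k y else 0) ≡ (if b then sum k else 0)
sum-if     true  k = refl
sum-if {q} false k = sum-replicate-zero q

sum-δ : ∀ {q} (e : Fin q) (h : Fin q → ℕ) → sum (λ x → if x == e then h x else 0) ≡ h e
sum-δ {suc q} zero    h = trans (cong (h zero +_) (sum-replicate-zero q)) (+-identityʳ (h zero))
sum-δ {suc q} (suc e) h = sum-δ e (λ x → h (suc x))

sum-δ₂ : ∀ {q r} (α : Fin q) (β : Fin r) (G : Fin q → Fin r → ℕ) →
  sum (λ a → sum (λ b → G a b * ind (a == α ∧ b == β))) ≡ G α β
sum-δ₂ α β G = begin
  sum (λ a → sum (λ b → G a b * ind (a == α ∧ b == β)))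
    ≡⟨ sum-cong-≗ (λ a → sum-cong-≗ (λ b → guard-∧ (a == α) (b == β) (G a b))) ⟩
  sum (λ a → sum (λ b → if a == α then (if b == β then G a b else 0) else 0))
    ≡⟨ sum-cong-≗ (λ a → sum-if (a == α) (λ b → if b == β then G a b else 0)) ⟩
  sum (λ a → if a == α then sum (λ b → if b == β then G a b else 0) else 0)
    ≡⟨ sum-δ α (λ a → sum (λ b → if b == β then G a b else 0)) ⟩
  sum (λ b → if b == β then G α b else 0)
    ≡⟨ sum-δ β (G α) ⟩
  G α β ∎
  where open ≡-Reasoning

sumExcept : ∀ {q} → Fin q → (Fin q → ℕ) → ℕ
sumExcept v k = sum (λ y → if y == v then 0 else k y)

sum-split : ∀ {q} (v : Fin q) (A B : Fin q → ℕ) →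
  sum (λ y → if y == v then A y else B y) ≡ A v + sumExcept v B
sum-split v A B = begin
  sum (λ y → if y == v then A y else B y)
    ≡⟨ sum-cong-≗ (λ y → guard-split (y == v) (A y) (B y)) ⟩
  sum (λ y → (if y == v then A y else 0) + (if y == v then 0 else B y))
    ≡⟨ ∑-distrib-+ (λ y → if y == v then A y else 0) (λ y → if y == v then 0 else B y) ⟩
  sum (λ y → if y == v then A y else 0) + sumExcept v B
    ≡⟨ cong (_+ sumExcept v B) (sum-δ v A) ⟩
  A v + sumExcept v B ∎
  where open ≡-Reasoning

sumExcept-cong : ∀ {q} (v : Fin q) {k l : Fin q → ℕ} → (∀ y → k y ≡ l y) → sumExcept v k ≡ sumExcept v l
sumExcept-cong v k≗l = sum-cong-≗ (λ y → cong (if y == v then 0 else_) (k≗l y))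

sumExcept-* : ∀ {q} (v : Fin q) c (k : Fin q → ℕ) → sumExcept v (λ y → c * k y) ≡ c * sumExcept v k
sumExcept-* v c k =
  trans (sum-cong-≗ (λ y → guard-* (y == v) c (k y))) (sym (*-distribˡ-sum c (λ y → if y == v then 0 else k y)))

sumExcept-sum : ∀ {q r} (v : Fin q) (H : Fin r → Fin q → ℕ) →
  sumExcept v (λ y → sum (λ a → H a y)) ≡ sum (λ a → sumExcept v (H a))
sumExcept-sum v H =
  trans (sum-cong-≗ (λ y → sym (sum-guard (y == v) (λ a → H a y)))) (∑-comm (λ y a → if y == v then 0 else H a y))

sumExcept-mono : ∀ {q} (v : Fin q) {k l : Fin q → ℕ} → (∀ y → k y ≤ l y) → sumExcept v k ≤ sumExcept v l
sumExcept-mono v k≤l = sum-mono (λ y → guard-≤ (y == v) (k≤l y))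

sumExcept-zero : ∀ {q} (v : Fin q) {k : Fin q → ℕ} → (∀ y → k y ≡ 0) → sumExcept v k ≡ 0
sumExcept-zero v k≡0 = sum-zero (λ y → guard-zero (y == v) (k≡0 y))

sumExcept-pos : ∀ {q} (v : Fin q) (k : Fin q → ℕ) → 0 < sumExcept v k → ∃ λ y → 0 < k y
sumExcept-pos v k pos with sum-pos (λ y → if y == v then 0 else k y) pos
... | y , posᵧ = y , guard-pos (y == v) posᵧ

term≤sumExcept : ∀ {q} {e v : Fin q} (k : Fin q → ℕ) → e ≢ v → k e ≤ sumExcept v k
term≤sumExcept {e = e} {v} k e≢v =
  subst (_≤ sumExcept v k) (cong (if_then 0 else k e) (==-false e≢v)) (term≤sum e (λ y → if y == v then 0 else k y))

sumExcept-δ : ∀ {q} (v e : Fin q) K → sumExcept v (λ y → if y == e then K else 0) ≡ (if v == e then 0 else K)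
sumExcept-δ v e K = begin
  sumExcept v (λ y → if y == e then K else 0)  ≡⟨ sum-cong-≗ (λ y → guard-swap (y == v) (y == e) K) ⟩
  sum (λ y → if y == e then (if y == v then 0 else K) else 0)  ≡⟨ sum-δ e (λ y → if y == v then 0 else K) ⟩
  (if e == v then 0 else K)  ≡⟨ cong (if_then 0 else K) (==-sym e v) ⟩
  (if v == e then 0 else K)  ∎
  where open ≡-Reasoning

sumExcept-1 : ∀ {p} (v : Fin (suc p)) → sumExcept v (λ _ → 1) ≡ p
sumExcept-1 {p} v = suc-injective (begin
  suc (sumExcept v (λ _ → 1))                   ≡⟨ sum-split v (λ _ → 1) (λ _ → 1) ⟨
  sum (λ y → if y == v then 1 else 1)          ≡⟨ sum-cong-≗ (λ y → same-branches (y == v)) ⟩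
  sum {suc p} (λ _ → 1)                         ≡⟨ sum-const {suc p} 1 ⟩
  suc p * 1                                     ≡⟨ *-identityʳ (suc p) ⟩
  suc p                                         ∎)
  where
  open ≡-Reasoning
  same-branches : ∀ b → (if b then 1 else 1) ≡ 1
  same-branches true  = refl
  same-branches false = refl

sumV : ∀ m q → (Vertex m q → ℕ) → ℕ
sumV zero    q h = h []
sumV (suc m) q h = sum (λ x → sumV m q (λ w → h (x ∷ w)))

sumV-cong : ∀ {m q} {h k : Vertex m q → ℕ} → (∀ w → h w ≡ k w) → sumV m q h ≡ sumV m q k
sumV-cong {zero}  h≗k = h≗k []
sumV-cong {suc m} h≗k = sum-cong-≗ (λ x → sumV-cong (λ w → h≗k (x ∷ w)))

sumV-zero : ∀ {m q} → sumV m q (λ _ → 0) ≡ 0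
sumV-zero {zero}      = refl
sumV-zero {suc m} {q} = sum-zero {q} (λ _ → sumV-zero {m} {q})

sumV-+ : ∀ {m q} (h k : Vertex m q → ℕ) → sumV m q (λ w → h w + k w) ≡ sumV m q h + sumV m q k
sumV-+ {zero}  h k = refl
sumV-+ {suc m} {q} h k =
  trans (sum-cong-≗ (λ x → sumV-+ (λ w → h (x ∷ w)) (λ w → k (x ∷ w))))
        (∑-distrib-+ (λ x → sumV m q (λ w → h (x ∷ w))) (λ x → sumV m q (λ w → k (x ∷ w))))

sumV-if : ∀ {m q} b (h k : Vertex m q → ℕ) →
  sumV m q (λ w → if b then h w else k w) ≡ (if b then sumV m q h else sumV m q k)
sumV-if true  h k = refl
sumV-if false h k = refl

sumL : ∀ {A : Set} → (A → ℕ) → List A → ℕ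
sumL h List.[]       = 0
sumL h (x List.∷ xs) = h x + sumL h xs

countB-sumL : ∀ {A : Set} (P : A → Bool) xs → countB P xs ≡ sumL (λ x → ind (P x)) xs
countB-sumL P List.[]       = refl
countB-sumL P (x List.∷ xs) = cong (ind (P x) +_) (countB-sumL P xs)

sumL-++ : ∀ {A : Set} (h : A → ℕ) xs ys → sumL h (xs List.++ ys) ≡ sumL h xs + sumL h ys
sumL-++ h List.[]       ys = refl
sumL-++ h (x List.∷ xs) ys = trans (cong (h x +_) (sumL-++ h xs ys)) (sym (+-assoc (h x) _ _))

sumL-concatMap : ∀ {A B : Set} (h : B → ℕ) (g : A → List B) xs →
  sumL h (List.concatMap g xs) ≡ sumL (λ x → sumL h (g x)) xs
sumL-concatMap h g List.[]       = refl
sumL-concatMap h g (x List.∷ xs) =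
  trans (sumL-++ h (g x) (List.concatMap g xs)) (cong (sumL h (g x) +_) (sumL-concatMap h g xs))

sumL-map : ∀ {A B : Set} (h : B → ℕ) (g : A → B) xs → sumL h (List.map g xs) ≡ sumL (λ x → h (g x)) xs
sumL-map h g List.[]       = refl
sumL-map h g (x List.∷ xs) = cong (h (g x) +_) (sumL-map h g xs)

sumL-tabulate : ∀ {A : Set} {q} (h : A → ℕ) (g : Fin q → A) → sumL h (List.tabulate g) ≡ sum (λ x → h (g x))
sumL-tabulate {q = zero}  h g = refl
sumL-tabulate {q = suc q} h g = cong (h (g zero) +_) (sumL-tabulate h (λ x → g (suc x)))

sumL-allVertices : ∀ m q (h : Vertex m q → ℕ) → sumL h (allVertices m q) ≡ sumV m q h
sumL-allVertices zero    q h = +-identityʳ (h [])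
sumL-allVertices (suc m) q h = begin
  sumL h (List.concatMap (λ x → List.map (x ∷_) (allVertices m q)) (List.allFin q))
    ≡⟨ sumL-concatMap h (λ x → List.map (x ∷_) (allVertices m q)) (List.allFin q) ⟩
  sumL (λ x → sumL h (List.map (x ∷_) (allVertices m q))) (List.allFin q)
    ≡⟨ sumL-tabulate (λ x → sumL h (List.map (x ∷_) (allVertices m q))) (λ x → x) ⟩
  sum (λ x → sumL h (List.map (x ∷_) (allVertices m q)))
    ≡⟨ sum-cong-≗ (λ x → trans (sumL-map h (x ∷_) (allVertices m q)) (sumL-allVertices m q (λ w → h (x ∷ w)))) ⟩
  sumV (suc m) q h ∎
  where open ≡-Reasoning

countB-allVertices : ∀ {m q} (P : Vertex m q → Bool) →
  countB P (allVertices m q) ≡ sumV m q (λ w → ind (P w))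
countB-allVertices {m} {q} P =
  trans (countB-sumL P (allVertices m q)) (sumL-allVertices m q (λ w → ind (P w)))

-- Neighbourhood sums:  nbrSum v h = Σ_{w ~ v} h w,  organised by the
-- coordinate in which w differs from v.
nbrSum : ∀ {m q} → Vertex m q → (Vertex m q → ℕ) → ℕ
nbrSum []       h = 0
nbrSum (v ∷ vs) h = nbrSum vs (λ w → h (v ∷ w)) + sumExcept v (λ y → h (y ∷ vs))

dist-step-0 : ∀ {q} (v₀ y : Fin q) d n →
  (if (if ⌊ v₀ ≟ y ⌋ then 0 else 1) + d ≡ᵇ 0 then n else 0) ≡ (if y == v₀ then (if d ≡ᵇ 0 then n else 0) else 0)
dist-step-0 v₀ y d n rewrite ==-sym y v₀ with v₀ ≟ y
... | yes _ = refl
... | no _  = refl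

dist-step-1 : ∀ {q} (v₀ y : Fin q) d n →
  (if (if ⌊ v₀ ≟ y ⌋ then 0 else 1) + d ≡ᵇ 1 then n else 0)
    ≡ (if y == v₀ then (if d ≡ᵇ 1 then n else 0) else (if d ≡ᵇ 0 then n else 0))
dist-step-1 v₀ y d n rewrite ==-sym y v₀ with v₀ ≟ y
... | yes _ = refl
... | no _  = refl

dist0-sum : ∀ {m q} (v : Vertex m q) (h : Vertex m q → ℕ) →
  sumV m q (λ w → if dist v w ≡ᵇ 0 then h w else 0) ≡ h v
dist0-sum []                  h = refl
dist0-sum {suc m} {q} (v₀ ∷ vs) h = begin
  sum (λ y → sumV m q (λ w → if dist (v₀ ∷ vs) (y ∷ w) ≡ᵇ 0 then h (y ∷ w) else 0))
    ≡⟨ sum-cong-≗ (λ y → sumV-cong (λ w → dist-step-0 v₀ y (dist vs w) (h (y ∷ w)))) ⟩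
  sum (λ y → sumV m q (λ w → if y == v₀ then H y w else 0))
    ≡⟨ sum-cong-≗ (λ y → trans (sumV-if (y == v₀) (H y) (λ _ → 0))
                                (cong (if y == v₀ then sumV m q (H y) else_) (sumV-zero {m} {q}))) ⟩
  sum (λ y → if y == v₀ then sumV m q (H y) else 0)
    ≡⟨ sum-δ v₀ (λ y → sumV m q (H y)) ⟩
  sumV m q (H v₀)
    ≡⟨ dist0-sum vs (λ w → h (v₀ ∷ w)) ⟩
  h (v₀ ∷ vs) ∎
  where
  open ≡-Reasoning
  H : Fin q → Vertex m q → ℕ
  H y w = if dist vs w ≡ᵇ 0 then h (y ∷ w) else 0

dist1-sum : ∀ {m q} (v : Vertex m q) (h : Vertex m q → ℕ) →
  sumV m q (λ w → if dist v w ≡ᵇ 1 then h w else 0) ≡ nbrSum v h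
dist1-sum []                  h = refl
dist1-sum {suc m} {q} (v₀ ∷ vs) h = begin
  sum (λ y → sumV m q (λ w → if dist (v₀ ∷ vs) (y ∷ w) ≡ᵇ 1 then h (y ∷ w) else 0))
    ≡⟨ sum-cong-≗ (λ y → sumV-cong (λ w → dist-step-1 v₀ y (dist vs w) (h (y ∷ w)))) ⟩
  sum (λ y → sumV m q (λ w → if y == v₀ then H₁ y w else H₀ y w))
    ≡⟨ sum-cong-≗ (λ y → sumV-if (y == v₀) (H₁ y) (H₀ y)) ⟩
  sum (λ y → if y == v₀ then sumV m q (H₁ y) else sumV m q (H₀ y))
    ≡⟨ sum-cong-≗ (λ y → cong₂ (if y == v₀ then_else_) (dist1-sum vs (λ w → h (y ∷ w)))
                                                      (dist0-sum vs (λ w → h (y ∷ w)))) ⟩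
  sum (λ y → if y == v₀ then nbrSum vs (λ w → h (y ∷ w)) else h (y ∷ vs))
    ≡⟨ sum-split v₀ (λ y → nbrSum vs (λ w → h (y ∷ w))) (λ y → h (y ∷ vs)) ⟩
  nbrSum (v₀ ∷ vs) h ∎
  where
  open ≡-Reasoning
  H₀ H₁ : Fin q → Vertex m q → ℕ
  H₀ y w = if dist vs w ≡ᵇ 0 then h (y ∷ w) else 0
  H₁ y w = if dist vs w ≡ᵇ 1 then h (y ∷ w) else 0


nbrSum-cong : ∀ {m q} (v : Vertex m q) {h k : Vertex m q → ℕ} → (∀ w → h w ≡ k w) → nbrSum v h ≡ nbrSum v k
nbrSum-cong []       h≗k = refl
nbrSum-cong (v ∷ vs) h≗k =
  cong₂ _+_ (nbrSum-cong vs (λ w → h≗k (v ∷ w))) (sumExcept-cong v (λ y → h≗k (y ∷ vs)))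

nbrSum-* : ∀ {m q} (v : Vertex m q) c (h : Vertex m q → ℕ) → nbrSum v (λ w → c * h w) ≡ c * nbrSum v h
nbrSum-* []       c h = sym (*-zeroʳ c)
nbrSum-* (v ∷ vs) c h =
  trans (cong₂ _+_ (nbrSum-* vs c (λ w → h (v ∷ w))) (sumExcept-* v c (λ y → h (y ∷ vs))))
        (sym (*-distribˡ-+ c _ _))

nbrSum-sum : ∀ {m q r} (v : Vertex m q) (H : Fin r → Vertex m q → ℕ) →
  nbrSum v (λ w → sum (λ a → H a w)) ≡ sum (λ a → nbrSum v (H a))
nbrSum-sum {r = r} [] H = sym (sum-replicate-zero r)
nbrSum-sum (v ∷ vs) H =
  trans (cong₂ _+_ (nbrSum-sum vs (λ a w → H a (v ∷ w))) (sumExcept-sum v (λ a y → H a (y ∷ vs))))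
        (sym (∑-distrib-+ (λ a → nbrSum vs (λ w → H a (v ∷ w))) (λ a → sumExcept v (λ y → H a (y ∷ vs)))))

nbrSum-mono : ∀ {m q} (v : Vertex m q) {h k : Vertex m q → ℕ} → (∀ w → h w ≤ k w) → nbrSum v h ≤ nbrSum v k
nbrSum-mono []       h≤k = z≤n
nbrSum-mono (v ∷ vs) h≤k =
  +-mono-≤ (nbrSum-mono vs (λ w → h≤k (v ∷ w))) (sumExcept-mono v (λ y → h≤k (y ∷ vs)))

degree : ∀ {m p} (v : Vertex m (suc p)) → nbrSum v (λ _ → 1) ≡ m * p
degree []                 = refl
degree {suc m} {p} (v ∷ vs) = trans (cong₂ _+_ (degree vs) (sumExcept-1 v)) (+-comm (m * p) p)

nbrSum-++ : ∀ {k m q} (ys : Vertex k q) (zs : Vertex m q) (h : Vertex (k + m) q → ℕ) →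
  nbrSum (ys ++ zs) h ≡ nbrSum ys (λ y → h (y ++ zs)) + nbrSum zs (λ z → h (ys ++ z))
nbrSum-++ []       zs h = refl
nbrSum-++ (v ∷ ys) zs h =
  trans (cong (_+ sumExcept v (λ y → h (y ∷ (ys ++ zs)))) (nbrSum-++ ys zs (λ w → h (v ∷ w))))
        (xy∙z≈xz∙y (nbrSum ys (λ y → h (v ∷ (y ++ zs)))) (nbrSum zs (λ z → h (v ∷ (ys ++ z)))) _)

nbrSum-pos : ∀ {m q} (v : Vertex m q) (h : Vertex m q → ℕ) → 0 < nbrSum v h → ∃ λ w → 0 < h w
nbrSum-pos (v ∷ vs) h pos with +-pos (nbrSum vs (λ w → h (v ∷ w))) _ pos
... | inj₁ pos₁ with nbrSum-pos vs (λ w → h (v ∷ w)) pos₁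
...   | w , pos-w = v ∷ w , pos-w
nbrSum-pos (v ∷ vs) h pos | inj₂ pos₂ with sumExcept-pos v (λ y → h (y ∷ vs)) pos₂
...   | y , pos-y = y ∷ vs , pos-y

nbrCount≡nbrSum : ∀ {m q k} (f : Vertex m q → Fin k) (v : Vertex m q) (j : Fin k) →
  nbrCount f v j ≡ nbrSum v (λ w → ind (f w == j))
nbrCount≡nbrSum {m} {q} f v j = begin
  nbrCount f v j
    ≡⟨ countB-allVertices (λ w → adjacentᵇ v w ∧ ⌊ f w ≟ j ⌋) ⟩
  sumV m q (λ w → ind (adjacentᵇ v w ∧ ⌊ f w ≟ j ⌋))
    ≡⟨ sumV-cong (λ w → ind-∧-if (adjacentᵇ v w) ⌊ f w ≟ j ⌋) ⟩
  sumV m q (λ w → if dist v w ≡ᵇ 1 then ind ⌊ f w ≟ j ⌋ else 0)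
    ≡⟨ dist1-sum v (λ w → ind ⌊ f w ≟ j ⌋) ⟩
  nbrSum v (λ w → ind ⌊ f w ≟ j ⌋)
    ≡⟨ nbrSum-cong v (λ w → cong ind (isYes≗does (f w ≟ j))) ⟩
  nbrSum v (λ w → ind (f w == j)) ∎
  where open ≡-Reasoning

ball-indicator : ∀ b d → ind (b ∧ (d ≤ᵇ 1)) ≡ (if d ≡ᵇ 0 then ind b else 0) + (if d ≡ᵇ 1 then ind b else 0)
ball-indicator true  zero          = refl
ball-indicator true  (suc zero)    = refl
ball-indicator true  (suc (suc d)) = refl
ball-indicator false zero          = refl
ball-indicator false (suc zero)    = refl
ball-indicator false (suc (suc d)) = refl

ball-count : ∀ {m q} (C : Vertex m q → Bool) (x : Vertex m q) →
  countB (λ c → C c ∧ (dist x c ≤ᵇ 1)) (allVertices m q) ≡ ind (C x) + nbrSum x (λ c → ind (C c))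
ball-count {m} {q} C x = begin
  countB (λ c → C c ∧ (dist x c ≤ᵇ 1)) (allVertices m q)
    ≡⟨ countB-allVertices (λ c → C c ∧ (dist x c ≤ᵇ 1)) ⟩
  sumV m q (λ c → ind (C c ∧ (dist x c ≤ᵇ 1)))
    ≡⟨ sumV-cong (λ c → ball-indicator (C c) (dist x c)) ⟩
  sumV m q (λ c → (if dist x c ≡ᵇ 0 then ind (C c) else 0) + (if dist x c ≡ᵇ 1 then ind (C c) else 0))
    ≡⟨ sumV-+ (λ c → if dist x c ≡ᵇ 0 then ind (C c) else 0) (λ c → if dist x c ≡ᵇ 1 then ind (C c) else 0) ⟩
  sumV m q (λ c → if dist x c ≡ᵇ 0 then ind (C c) else 0) + sumV m q (λ c → if dist x c ≡ᵇ 1 then ind (C c) else 0)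
    ≡⟨ cong₂ _+_ (dist0-sum x (λ c → ind (C c))) (dist1-sum x (λ c → ind (C c))) ⟩
  ind (C x) + nbrSum x (λ c → ind (C c)) ∎
  where open ≡-Reasoning

-- Addition and subtraction modulo q on Fin q.  Each translation x ↦ x ⊕ s is
-- a bijection with inverse t ↦ t ⊖ s, i.e. ⊕ is a Latin square.
module ZMod (p : ℕ) where
  private
    q : ℕ
    q = suc p

  infixl 8 _⊕_ _⊖_

  _⊕_ : Fin q → Fin q → Fin q
  x ⊕ y = fromℕ< (m%n<n (toℕ x + toℕ y) q)

  _⊖_ : Fin q → Fin q → Fin q
  t ⊖ s = fromℕ< (m%n<n (toℕ t + (q ∸ toℕ s)) q)

  private
    toℕ-⊕ : ∀ x y → toℕ (x ⊕ y) ≡ (toℕ x + toℕ y) % q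
    toℕ-⊕ x y = Finₚ.toℕ-fromℕ< (m%n<n (toℕ x + toℕ y) q)

    toℕ-⊖ : ∀ t s → toℕ (t ⊖ s) ≡ (toℕ t + (q ∸ toℕ s)) % q
    toℕ-⊖ t s = Finₚ.toℕ-fromℕ< (m%n<n (toℕ t + (q ∸ toℕ s)) q)

    toℕ-mod : ∀ (x : Fin q) → toℕ x % q ≡ toℕ x
    toℕ-mod x = m<n⇒m%n≡m (Finₚ.toℕ<n x)

    %-add-q : ∀ m a b → a + b ≡ q → ((m + a) % q + b) % q ≡ m % q
    %-add-q m a b a+b≡q = begin
      ((m + a) % q + b) % q           ≡⟨ %-distribˡ-+ ((m + a) % q) b q ⟩
      ((m + a) % q % q + b % q) % q   ≡⟨ cong (λ z → (z + b % q) % q) (m%n%n≡m%n (m + a) q) ⟩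
      ((m + a) % q + b % q) % q       ≡⟨ %-distribˡ-+ (m + a) b q ⟨
      (m + a + b) % q                 ≡⟨ cong (_% q) (+-assoc m a b) ⟩
      (m + (a + b)) % q               ≡⟨ cong (λ z → (m + z) % q) a+b≡q ⟩
      (m + q) % q                     ≡⟨ [m+n]%n≡m%n m q ⟩
      m % q                           ∎
      where open ≡-Reasoning

    s≤q : ∀ (s : Fin q) → toℕ s ≤ q
    s≤q s = <⇒≤ (Finₚ.toℕ<n s)

  ⊕-comm : ∀ x y → x ⊕ y ≡ y ⊕ x
  ⊕-comm x y = Finₚ.toℕ-injective (begin
    toℕ (x ⊕ y)          ≡⟨ toℕ-⊕ x y ⟩
    (toℕ x + toℕ y) % q  ≡⟨ cong (_% q) (+-comm (toℕ x) (toℕ y)) ⟩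
    (toℕ y + toℕ x) % q  ≡⟨ toℕ-⊕ y x ⟨
    toℕ (y ⊕ x)          ∎)
    where open ≡-Reasoning

  ⊖-⊕ : ∀ t s → t ⊖ s ⊕ s ≡ t
  ⊖-⊕ t s = Finₚ.toℕ-injective (begin
    toℕ (t ⊖ s ⊕ s)                                   ≡⟨ toℕ-⊕ (t ⊖ s) s ⟩
    (toℕ (t ⊖ s) + toℕ s) % q                         ≡⟨ cong (λ z → (z + toℕ s) % q) (toℕ-⊖ t s) ⟩
    ((toℕ t + (q ∸ toℕ s)) % q + toℕ s) % q           ≡⟨ %-add-q (toℕ t) (q ∸ toℕ s) (toℕ s) (m∸n+n≡m (s≤q s)) ⟩
    toℕ t % q                                         ≡⟨ toℕ-mod t ⟩
    toℕ t                                             ∎)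
    where open ≡-Reasoning

  ⊕-cancel : ∀ x s t → x ⊕ s ≡ t → x ≡ t ⊖ s
  ⊕-cancel x s t x⊕s≡t = Finₚ.toℕ-injective (begin
    toℕ x                                             ≡⟨ toℕ-mod x ⟨
    toℕ x % q                                         ≡⟨ %-add-q (toℕ x) (toℕ s) (q ∸ toℕ s) (m+[n∸m]≡n (s≤q s)) ⟨
    ((toℕ x + toℕ s) % q + (q ∸ toℕ s)) % q           ≡⟨ cong (λ z → (z + (q ∸ toℕ s)) % q) (toℕ-⊕ x s) ⟨
    (toℕ (x ⊕ s) + (q ∸ toℕ s)) % q                   ≡⟨ cong (λ z → (toℕ z + (q ∸ toℕ s)) % q) x⊕s≡t ⟩
    (toℕ t + (q ∸ toℕ s)) % q                         ≡⟨ toℕ-⊖ t s ⟨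
    toℕ (t ⊖ s)                                       ∎)
    where open ≡-Reasoning

  ⊕-==ˡ : ∀ x s t → (x ⊕ s == t) ≡ (x == t ⊖ s)
  ⊕-==ˡ x s t with x ⊕ s ≟ t | x ≟ t ⊖ s
  ... | yes _     | yes _    = refl
  ... | no _      | no _     = refl
  ... | yes x⊕s≡t | no x≢t⊖s = ⊥-elim (x≢t⊖s (⊕-cancel x s t x⊕s≡t))
  ... | no x⊕s≢t  | yes refl = ⊥-elim (x⊕s≢t (⊖-⊕ t s))

  ⊕-==ʳ : ∀ s x t → (s ⊕ x == t) ≡ (x == t ⊖ s)
  ⊕-==ʳ s x t = trans (cong (_== t) (⊕-comm s x)) (⊕-==ˡ x s t)

  column-sum : ∀ s t → sum (λ x → ind (x ⊕ s == t)) ≡ 1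
  column-sum s t = trans (sum-cong-≗ (λ x → cong ind (⊕-==ˡ x s t))) (sum-δ (t ⊖ s) (λ _ → 1))

  ==-⊕ : ∀ t s x → (t == s ⊕ x) ≡ (t ⊖ s == x)
  ==-⊕ t s x = trans (==-sym t (s ⊕ x)) (trans (⊕-==ʳ s x t) (==-sym x (t ⊖ s)))

-- (φ,ψ) : H(k,q) → Z_q × Z_q is a local covering if the neighbours of every Y
-- are sent bijectively onto the pairs (a,b) with a ≠ φ Y.
IsLocalCovering : ∀ {k q} → (Vertex k q → Fin q) → (Vertex k q → Fin q) → Set
IsLocalCovering {k} {q} φ ψ =
  ∀ (Y : Vertex k q) (a b : Fin q) → nbrSum Y (λ Y' → ind (a == φ Y' ∧ b == ψ Y')) ≡ ind (not (a == φ Y))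

-- A 1-perfect code C in H(q+1,q), q = p+1, is the graph of a map
-- u ↦ (codeX u, codeY u) on H(q-1,q), and it yields a local covering of H(q,q).
module PerfectCode (p : ℕ) (C : Vertex (suc (suc p)) (suc p) → Bool)
                   (perfect : IsOnePerfectCode (suc (suc p)) (suc p) C) where
  open ZMod p

  private
    q : ℕ
    q = suc p

  codeword : Vertex (suc q) q → ℕ
  codeword c = ind (C c)

  inTail inSecond inFirst : Fin q → Fin q → Vertex p q → ℕ
  inTail   x y u = nbrSum u (λ w → codeword (x ∷ y ∷ w))
  inSecond x y u = sumExcept y (λ y' → codeword (x ∷ y' ∷ u))
  inFirst  x y u = sumExcept x (λ x' → codeword (x' ∷ y ∷ u))

  ball : ∀ x y u → codeword (x ∷ y ∷ u) + ((inTail x y u + inSecond x y u) + inFirst x y u) ≡ 1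
  ball x y u = trans (sym (ball-count C (x ∷ y ∷ u))) (perfect (x ∷ y ∷ u))

  private
    codeword-pos : ∀ {c} → C c ≡ true → 1 ≤ codeword c
    codeword-pos C∋c rewrite C∋c = ≤-refl

    overfull : ∀ x y u → ¬ 2 ≤ codeword (x ∷ y ∷ u) + ((inTail x y u + inSecond x y u) + inFirst x y u)
    overfull x y u two≤ with subst (2 ≤_) (ball x y u) two≤
    ... | s≤s ()

    self-and-second : ∀ x y u → 1 ≤ codeword (x ∷ y ∷ u) → 1 ≤ inSecond x y u → ⊥
    self-and-second x y u 1≤A 1≤B = overfull x y u (+-mono-≤ 1≤A
      (≤-trans 1≤B (≤-trans (m≤n+m (inSecond x y u) (inTail x y u))
                             (m≤m+n (inTail x y u + inSecond x y u) (inFirst x y u)))))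

    self-and-first : ∀ x y u → 1 ≤ codeword (x ∷ y ∷ u) → 1 ≤ inFirst x y u → ⊥
    self-and-first x y u 1≤A 1≤D = overfull x y u (+-mono-≤ 1≤A
      (≤-trans 1≤D (m≤n+m (inFirst x y u) (inTail x y u + inSecond x y u))))

    second-and-first : ∀ x y u → 1 ≤ inSecond x y u → 1 ≤ inFirst x y u → ⊥
    second-and-first x y u 1≤B 1≤D = overfull x y u (≤-trans
      (+-mono-≤ (≤-trans 1≤B (m≤n+m (inSecond x y u) (inTail x y u))) 1≤D)
      (m≤n+m ((inTail x y u + inSecond x y u) + inFirst x y u) (codeword (x ∷ y ∷ u))))

  -- Two codewords over the same u coincide: both lie in the ball around x ∷ y' ∷ u.
  fibre-unique : ∀ {x y x' y' u} → C (x ∷ y ∷ u) ≡ true → C (x' ∷ y' ∷ u) ≡ true → x ≡ x' × y ≡ y'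
  fibre-unique {x} {y} {x'} {y'} {u} c c' with x ≟ x' | y ≟ y'
  ... | yes x≡x' | yes y≡y' = x≡x' , y≡y'
  ... | yes refl | no y≢y' = ⊥-elim (self-and-second x y' u (codeword-pos c')
          (≤-trans (codeword-pos c) (term≤sumExcept (λ y'' → codeword (x ∷ y'' ∷ u)) y≢y')))
  ... | no x≢x'  | yes refl = ⊥-elim (self-and-first x y u (codeword-pos c)
          (≤-trans (codeword-pos c') (term≤sumExcept (λ x'' → codeword (x'' ∷ y ∷ u)) (≢-sym x≢x'))))
  ... | no x≢x'  | no y≢y' = ⊥-elim (second-and-first x y' u
          (≤-trans (codeword-pos c) (term≤sumExcept (λ y'' → codeword (x ∷ y'' ∷ u)) y≢y'))
          (≤-trans (codeword-pos c') (term≤sumExcept (λ x'' → codeword (x'' ∷ y' ∷ u)) (≢-sym x≢x'))))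

  codeword-at : ∀ {x₀ y₀ w} → C (x₀ ∷ y₀ ∷ w) ≡ true →
                ∀ x y → codeword (x ∷ y ∷ w) ≡ ind (x == x₀ ∧ y == y₀)
  codeword-at {x₀} {y₀} {w} c₀ x y with x ≟ x₀ | y ≟ y₀
  ... | yes refl | yes refl = cong ind c₀
  ... | yes refl | no y≢y₀  = cong ind (Boolₚ.¬-not (λ c → y≢y₀ (proj₂ (fibre-unique c c₀))))
  ... | no x≢x₀  | _        = cong ind (Boolₚ.¬-not (λ c → x≢x₀ (proj₁ (fibre-unique c c₀))))

  fibre? : ∀ u → Dec (∃₂ λ x y → C (x ∷ y ∷ u) ≡ true)
  fibre? u = Finₚ.any? (λ x → Finₚ.any? (λ y → C (x ∷ y ∷ u) Boolₚ.≟ true))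

  fibre-size : ∀ w → sum (λ x → sum (λ y → codeword (x ∷ y ∷ w))) ≤ 1
  fibre-size w with fibre? w
  ... | yes (x₀ , y₀ , c₀) = ≤-reflexive (begin
    sum (λ x → sum (λ y → codeword (x ∷ y ∷ w)))
      ≡⟨ sum-cong-≗ (λ x → sum-cong-≗ (λ y → trans (codeword-at c₀ x y) (sym (*-identityˡ _)))) ⟩
    sum (λ x → sum (λ y → 1 * ind (x == x₀ ∧ y == y₀)))
      ≡⟨ sum-δ₂ x₀ y₀ (λ _ _ → 1) ⟩
    1 ∎)
    where open ≡-Reasoning
  ... | no empty = subst (_≤ 1) (sym (sum-zero (λ x → sum-zero (λ y →
    cong ind (Boolₚ.¬-not (λ c → empty (x , y , c))))))) z≤n

  tail-only : ∀ u → (∀ x y → C (x ∷ y ∷ u) ≡ false) → ∀ x y → inTail x y u ≡ 1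
  tail-only u empty x y = begin
    inTail x y u                                   ≡⟨ +-identityʳ (inTail x y u) ⟨
    inTail x y u + 0                               ≡⟨ +-identityʳ (inTail x y u + 0) ⟨
    (inTail x y u + 0) + 0
      ≡⟨ cong₂ (λ B D → (inTail x y u + B) + D) (sumExcept-zero y (λ y' → cong ind (empty x y')))
                                                  (sumExcept-zero x (λ x' → cong ind (empty x' y))) ⟨
    (inTail x y u + inSecond x y u) + inFirst x y u
      ≡⟨ cong (λ A → A + ((inTail x y u + inSecond x y u) + inFirst x y u)) (cong ind (empty x y)) ⟨
    codeword (x ∷ y ∷ u) + ((inTail x y u + inSecond x y u) + inFirst x y u) ≡⟨ ball x y u ⟩
    1                                              ∎
    where open ≡-Reasoning

  -- Every fibre is non-empty: otherwise, counting the pairs (x,y) through the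
  -- neighbours w of u, q² = Σ_{w~u} |fibre over w| ≤ deg u = p², absurd.
  fibre-nonempty : ∀ u → ∃₂ λ x y → C (x ∷ y ∷ u) ≡ true
  fibre-nonempty u with fibre? u
  ... | yes found = found
  ... | no none = ⊥-elim (<⇒≱ (*-mono-< (n<1+n p) (n<1+n p)) (begin
    q * q                                                       ≡⟨ cong (q *_) (*-identityʳ q) ⟨
    q * (q * 1)                                                 ≡⟨ sum-const {q} (q * 1) ⟨
    sum {q} (λ x → q * 1)                                       ≡⟨ sum-cong-≗ {q} (λ x → sum-const {q} 1) ⟨
    sum {q} (λ x → sum {q} (λ y → 1))
      ≡⟨ sum-cong-≗ (λ x → sum-cong-≗ (λ y → tail-only u empty x y)) ⟨
    sum (λ x → sum (λ y → inTail x y u))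
      ≡⟨ sum-cong-≗ (λ x → nbrSum-sum u (λ y w → codeword (x ∷ y ∷ w))) ⟨
    sum (λ x → nbrSum u (λ w → sum (λ y → codeword (x ∷ y ∷ w))))
      ≡⟨ nbrSum-sum u (λ x w → sum (λ y → codeword (x ∷ y ∷ w))) ⟨
    nbrSum u (λ w → sum (λ x → sum (λ y → codeword (x ∷ y ∷ w)))) ≤⟨ nbrSum-mono u fibre-size ⟩
    nbrSum u (λ _ → 1)                                          ≡⟨ degree u ⟩
    p * p                                                       ∎))
    where
    open ≤-Reasoning
    empty : ∀ x y → C (x ∷ y ∷ u) ≡ false
    empty x y = Boolₚ.¬-not (λ c → none (x , y , c))

  codeX codeY : Vertex p q → Fin q
  codeX u = proj₁ (fibre-nonempty u)
  codeY u = proj₁ (proj₂ (fibre-nonempty u))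

  codeword-char : ∀ x y u → codeword (x ∷ y ∷ u) ≡ ind (x == codeX u ∧ y == codeY u)
  codeword-char x y u = codeword-at (proj₂ (proj₂ (fibre-nonempty u))) x y

  second-coordinate : ∀ e b u → inSecond e b u ≡ ind (not (b == codeY u) ∧ e == codeX u)
  second-coordinate e b u = begin
    inSecond e b u
      ≡⟨ sumExcept-cong b (λ y → trans (codeword-char e y u)
           (trans (cong ind (Boolₚ.∧-comm (e == codeX u) (y == codeY u))) (ind-∧-if (y == codeY u) (e == codeX u)))) ⟩
    sumExcept b (λ y → if y == codeY u then ind (e == codeX u) else 0)
      ≡⟨ sumExcept-δ b (codeY u) (ind (e == codeX u)) ⟩
    (if b == codeY u then 0 else ind (e == codeX u))
      ≡⟨ guard-ind (b == codeY u) (e == codeX u) ⟩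
    ind (not (b == codeY u) ∧ e == codeX u) ∎
    where open ≡-Reasoning

  first-coordinate : ∀ e b u → inFirst e b u ≡ ind (not (e == codeX u) ∧ b == codeY u)
  first-coordinate e b u = begin
    inFirst e b u
      ≡⟨ sumExcept-cong e (λ x → trans (codeword-char x b u) (ind-∧-if (x == codeX u) (b == codeY u))) ⟩
    sumExcept e (λ x → if x == codeX u then ind (b == codeY u) else 0)
      ≡⟨ sumExcept-δ e (codeX u) (ind (b == codeY u)) ⟩
    (if e == codeX u then 0 else ind (b == codeY u))
      ≡⟨ guard-ind (e == codeX u) (b == codeY u) ⟩
    ind (not (e == codeX u) ∧ b == codeY u) ∎
    where open ≡-Reasoning

  private
    split-on-Q : ∀ R Q → ind (R ∧ Q) + ind (not Q ∧ R) ≡ ind R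
    split-on-Q true  true  = refl
    split-on-Q true  false = refl
    split-on-Q false true  = refl
    split-on-Q false false = refl

    excluded-middle : ∀ R → ind R + ind (not R) ≡ 1
    excluded-middle true  = refl
    excluded-middle false = refl

  -- The codeword in the ball around e ∷ b ∷ u lies in the fibre over u exactly
  -- when e = codeX u; otherwise it differs from e ∷ b ∷ u in u or in e.
  outside-fibre : ∀ e b u → inTail e b u + ind (not (e == codeX u) ∧ b == codeY u) ≡ ind (not (e == codeX u))
  outside-fibre e b u = +-cancelˡ-≡ (ind R) _ _ (begin
    ind R + (N + D)                                  ≡⟨ cong (_+ (N + D)) (split-on-Q R Q) ⟨
    (ind (R ∧ Q) + ind (not Q ∧ R)) + (N + D)
      ≡⟨ trans (+-assoc (ind (R ∧ Q)) _ (N + D)) (cong (ind (R ∧ Q) +_) (x∙yz≈yx∙z (ind (not Q ∧ R)) N D)) ⟩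
    ind (R ∧ Q) + ((N + ind (not Q ∧ R)) + D)
      ≡⟨ cong₂ (λ A B → A + ((N + B) + D)) (codeword-char e b u) (second-coordinate e b u) ⟨
    codeword (e ∷ b ∷ u) + ((N + inSecond e b u) + D)
      ≡⟨ cong (λ D' → codeword (e ∷ b ∷ u) + ((N + inSecond e b u) + D')) (first-coordinate e b u) ⟨
    codeword (e ∷ b ∷ u) + ((N + inSecond e b u) + inFirst e b u)  ≡⟨ ball e b u ⟩
    1                                                ≡⟨ excluded-middle R ⟨
    ind R + ind (not R)                              ∎)
    where
    open ≡-Reasoning
    R Q : Bool
    R = e == codeX u
    Q = b == codeY u
    N D : ℕ
    N = inTail e b u
    D = ind (not R ∧ Q)

  φ ψ : Vertex q q → Fin q
  φ (v ∷ u) = v ⊕ codeX u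
  ψ (v ∷ u) = codeY u

  tail-neighbours : ∀ v u a b → nbrSum u (λ w → ind (a == v ⊕ codeX w ∧ b == codeY w)) ≡ inTail (a ⊖ v) b u
  tail-neighbours v u a b = nbrSum-cong u (λ w →
    trans (cong (λ r → ind (r ∧ b == codeY w)) (==-⊕ a v (codeX w))) (sym (codeword-char (a ⊖ v) b w)))

  head-neighbours : ∀ v u a b →
    sumExcept v (λ x → ind (a == x ⊕ codeX u ∧ b == codeY u)) ≡ ind (not (a ⊖ v == codeX u) ∧ b == codeY u)
  head-neighbours v u a b = begin
    sumExcept v (λ x → ind (a == x ⊕ codeX u ∧ Q))
      ≡⟨ sumExcept-cong v (λ x → trans (cong (λ r → ind (r ∧ Q)) (solve-for x)) (ind-∧-if (x == a ⊖ codeX u) Q)) ⟩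
    sumExcept v (λ x → if x == a ⊖ codeX u then ind Q else 0)
      ≡⟨ sumExcept-δ v (a ⊖ codeX u) (ind Q) ⟩
    (if v == a ⊖ codeX u then 0 else ind Q)
      ≡⟨ cong (if_then 0 else ind Q) same-test ⟩
    (if a ⊖ v == codeX u then 0 else ind Q)
      ≡⟨ guard-ind (a ⊖ v == codeX u) Q ⟩
    ind (not (a ⊖ v == codeX u) ∧ Q) ∎
    where
    open ≡-Reasoning
    Q : Bool
    Q = b == codeY u
    solve-for : ∀ x → (a == x ⊕ codeX u) ≡ (x == a ⊖ codeX u)
    solve-for x = trans (==-sym a (x ⊕ codeX u)) (⊕-==ˡ x (codeX u) a)
    -- both tests say a = v ⊕ codeX u
    same-test : (v == a ⊖ codeX u) ≡ (a ⊖ v == codeX u)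
    same-test = trans (sym (solve-for v)) (==-⊕ a v (codeX u))

  local-covering : IsLocalCovering φ ψ
  local-covering (v ∷ u) a b = begin
    nbrSum u (λ w → ind (a == v ⊕ codeX w ∧ b == codeY w))
      + sumExcept v (λ x → ind (a == x ⊕ codeX u ∧ b == codeY u))
      ≡⟨ cong₂ _+_ (tail-neighbours v u a b) (head-neighbours v u a b) ⟩
    inTail (a ⊖ v) b u + ind (not (a ⊖ v == codeX u) ∧ b == codeY u)
      ≡⟨ outside-fibre (a ⊖ v) b u ⟩
    ind (not (a ⊖ v == codeX u))
      ≡⟨ cong (λ r → ind (not r)) (==-⊕ a v (codeX u)) ⟨
    ind (not (a == v ⊕ codeX u)) ∎
    where open ≡-Reasoning

-- (π,σ) : H(m,q) → H(n,q) × Fin r is a covering if, for every X and t, the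
-- neighbours W of X with σ W = t are sent by π bijectively onto the neighbours
-- of π X.
IsCovering : ∀ {m n q r} → (Vertex m q → Vertex n q) → (Vertex m q → Fin r) → Set
IsCovering {m} {n} {q} {r} π σ =
  ∀ (X : Vertex m q) (h : Vertex n q → ℕ) (t : Fin r) → nbrSum X (λ W → h (π W) * ind (σ W == t)) ≡ nbrSum (π X) h

take-++ : ∀ {A : Set} {k m} (ys : Vec A k) (zs : Vec A m) → take k (ys ++ zs) ≡ ys
take-++ []       zs = refl
take-++ (y ∷ ys) zs = cong (y ∷_) (take-++ ys zs)

drop-++ : ∀ {A : Set} {k m} (ys : Vec A k) (zs : Vec A m) → drop k (ys ++ zs) ≡ zs
drop-++ []       zs = refl
drop-++ (y ∷ ys) zs = drop-++ ys zs

module Blockwise (p : ℕ) {k : ℕ} (φ ψ : Vertex k (suc (suc p)) → Fin (suc (suc p)))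
                 (local : IsLocalCovering φ ψ) where
  open ZMod (suc p)

  private
    q : ℕ
    q = suc (suc p)

  -- Neighbourhood sums of functions of (φ,ψ): the neighbours of Y realise each
  -- pair (a,b) with a ≠ φ Y exactly once.
  local-sum : ∀ (Y : Vertex k q) (G : Fin q → Fin q → ℕ) →
    nbrSum Y (λ Y' → G (φ Y') (ψ Y')) ≡ sumExcept (φ Y) (λ a → sum (G a))
  local-sum Y G = begin
    nbrSum Y (λ Y' → G (φ Y') (ψ Y'))
      ≡⟨ nbrSum-cong Y (λ Y' → sum-δ₂ (φ Y') (ψ Y') G) ⟨
    nbrSum Y (λ Y' → sum (λ a → sum (λ b → G a b * ind (a == φ Y' ∧ b == ψ Y'))))
      ≡⟨ nbrSum-sum Y (λ a Y' → sum (λ b → G a b * ind (a == φ Y' ∧ b == ψ Y'))) ⟩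
    sum (λ a → nbrSum Y (λ Y' → sum (λ b → G a b * ind (a == φ Y' ∧ b == ψ Y'))))
      ≡⟨ sum-cong-≗ (λ a → nbrSum-sum Y (λ b Y' → G a b * ind (a == φ Y' ∧ b == ψ Y'))) ⟩
    sum (λ a → sum (λ b → nbrSum Y (λ Y' → G a b * ind (a == φ Y' ∧ b == ψ Y'))))
      ≡⟨ sum-cong-≗ (λ a → sum-cong-≗ (λ b →
           trans (nbrSum-* Y (G a b) (λ Y' → ind (a == φ Y' ∧ b == ψ Y'))) (cong (G a b *_) (local Y a b)))) ⟩
    sum (λ a → sum (λ b → G a b * ind (not (a == φ Y))))
      ≡⟨ sum-cong-≗ (λ a → trans (sum-cong-≗ (λ b → mask (a == φ Y) (G a b))) (sum-guard (a == φ Y) (G a))) ⟩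
    sumExcept (φ Y) (λ a → sum (G a)) ∎
    where open ≡-Reasoning

  -- Every pair (a,b) with a ≠ φ Y is realised by a neighbour of Y ...
  realised-near : ∀ Y a b → a ≢ φ Y → ∃ λ Y' → φ Y' ≡ a × ψ Y' ≡ b
  realised-near Y a b a≢φY with nbrSum-pos Y (λ Y' → ind (a == φ Y' ∧ b == ψ Y')) one-realiser
    where
    one-realiser : 0 < nbrSum Y (λ Y' → ind (a == φ Y' ∧ b == ψ Y'))
    one-realiser = subst (0 <_) (sym (trans (local Y a b) (cong (λ r → ind (not r)) (==-false a≢φY)))) (s≤s z≤n)
  ... | Y' , pos with ind-∧-pos (a == φ Y') (b == ψ Y') pos
  ...   | a≡φY' , b≡ψY' = Y' , sym (==-sound a≡φY') , sym (==-sound b≡ψY')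

  private
    other : Fin q → Fin q
    other zero    = suc zero
    other (suc _) = zero

    other-≢ : ∀ a → a ≢ other a
    other-≢ zero    ()
    other-≢ (suc _) ()

    Y₀ : Vertex k q
    Y₀ = replicate k zero

  -- ... hence every pair (a,b) is realised: if φ Y₀ = a, first move to a
  -- neighbour Y₁ of Y₀ with φ Y₁ ≠ a.
  local-onto : ∀ a b → ∃ λ Y → φ Y ≡ a × ψ Y ≡ b
  local-onto a b with a ≟ φ Y₀
  ... | no a≢φY₀  = realised-near Y₀ a b a≢φY₀
  ... | yes a≡φY₀ with realised-near Y₀ (other a) b (λ o≡φY₀ → other-≢ a (trans a≡φY₀ (sym o≡φY₀)))
  ...   | Y₁ , φY₁≡o , _ = realised-near Y₁ a b (λ a≡φY₁ → other-≢ a (trans a≡φY₁ φY₁≡o))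

  π : ∀ n → Vertex (n * k) q → Vertex n q
  π zero    X = []
  π (suc n) X = φ (take k X) ∷ π n (drop k X)

  σ : ∀ n → Vertex (n * k) q → Fin q
  σ zero    X = zero
  σ (suc n) X = ψ (take k X) ⊕ σ n (drop k X)

  π-++ : ∀ n (Y : Vertex k q) (Z : Vertex (n * k) q) → π (suc n) (Y ++ Z) ≡ φ Y ∷ π n Z
  π-++ n Y Z = cong₂ (λ Y Z → φ Y ∷ π n Z) (take-++ Y Z) (drop-++ Y Z)

  σ-++ : ∀ n (Y : Vertex k q) (Z : Vertex (n * k) q) → σ (suc n) (Y ++ Z) ≡ ψ Y ⊕ σ n Z
  σ-++ n Y Z = cong₂ (λ Y Z → ψ Y ⊕ σ n Z) (take-++ Y Z) (drop-++ Y Z)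

  -- Varying the first block: by local-sum and the Latin square property, the
  -- neighbours Y' of Y with ψ Y' ⊕ s = t contribute Σ_{a ≠ φ Y} h' a.
  first-block-sum : ∀ (Y : Vertex k q) (h' : Fin q → ℕ) s t →
    nbrSum Y (λ Y' → h' (φ Y') * ind (ψ Y' ⊕ s == t)) ≡ sumExcept (φ Y) h'
  first-block-sum Y h' s t = trans (local-sum Y (λ a b → h' a * ind (b ⊕ s == t)))
    (sumExcept-cong (φ Y) (λ a → begin
      sum (λ b → h' a * ind (b ⊕ s == t))  ≡⟨ *-distribˡ-sum (h' a) (λ b → ind (b ⊕ s == t)) ⟨
      h' a * sum (λ b → ind (b ⊕ s == t))  ≡⟨ cong (h' a *_) (column-sum s t) ⟩
      h' a * 1                             ≡⟨ *-identityʳ (h' a) ⟩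
      h' a                                 ∎))
    where open ≡-Reasoning

  -- (π n, σ n) is a covering, by induction on the number of blocks: a neighbour
  -- of Y ++ Z changes either the first block (handled by first-block-sum) or
  -- the rest (handled by induction, with the target t ⊖ ψ Y).
  covering : ∀ n → IsCovering (π n) (σ n)
  covering zero    [] h t = refl
  covering (suc n) X  h t =
    subst (λ X → nbrSum X (H) ≡ nbrSum (π (suc n) X) h) (take++drop≡id k X) (covering-++ (take k X) (drop k X))
    where
    H : Vertex (suc n * k) q → ℕ
    H W = h (π (suc n) W) * ind (σ (suc n) W == t)

    covering-++ : ∀ Y Z → nbrSum (Y ++ Z) (H) ≡ nbrSum (π (suc n) (Y ++ Z)) h
    covering-++ Y Z = begin
      nbrSum (Y ++ Z) (H)
        ≡⟨ nbrSum-++ Y Z (H) ⟩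
      nbrSum Y (λ Y' → H (Y' ++ Z)) + nbrSum Z (λ Z' → H (Y ++ Z'))
        ≡⟨ cong₂ _+_ (nbrSum-cong Y (λ Y' → H-++ Y' Z)) (nbrSum-cong Z (λ Z' → H-++ Y Z')) ⟩
      nbrSum Y (λ Y' → h (φ Y' ∷ π n Z) * ind (ψ Y' ⊕ σ n Z == t))
        + nbrSum Z (λ Z' → h (φ Y ∷ π n Z') * ind (ψ Y ⊕ σ n Z' == t))
        ≡⟨ cong₂ _+_ (first-block-sum Y (λ a → h (a ∷ π n Z)) (σ n Z) t) rest ⟩
      sumExcept (φ Y) (λ a → h (a ∷ π n Z)) + nbrSum (π n Z) (λ w → h (φ Y ∷ w))
        ≡⟨ +-comm (sumExcept (φ Y) (λ a → h (a ∷ π n Z))) _ ⟩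
      nbrSum (φ Y ∷ π n Z) h
        ≡⟨ cong (λ v → nbrSum v h) (π-++ n Y Z) ⟨
      nbrSum (π (suc n) (Y ++ Z)) h ∎
      where
      open ≡-Reasoning
      H-++ : ∀ Y' Z' → H (Y' ++ Z') ≡ h (φ Y' ∷ π n Z') * ind (ψ Y' ⊕ σ n Z' == t)
      H-++ Y' Z' = cong₂ (λ v s → h v * ind (s == t)) (π-++ n Y' Z') (σ-++ n Y' Z')
      rest : nbrSum Z (λ Z' → h (φ Y ∷ π n Z') * ind (ψ Y ⊕ σ n Z' == t)) ≡ nbrSum (π n Z) (λ w → h (φ Y ∷ w))
      rest = trans (nbrSum-cong Z (λ Z' → cong (λ r → h (φ Y ∷ π n Z') * ind r) (⊕-==ʳ (ψ Y) (σ n Z') t)))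
                   (covering n Z (λ w → h (φ Y ∷ w)) (t ⊖ ψ Y))

  π-onto : ∀ n (v : Vertex n q) → ∃ λ X → π n X ≡ v
  π-onto zero    []       = [] , refl
  π-onto (suc n) (a ∷ vs) with π-onto n vs | local-onto a zero
  ... | Z , πZ≡vs | Y , φY≡a , _ = Y ++ Z , trans (π-++ n Y Z) (cong₂ _∷_ φY≡a πZ≡vs)

  onto : ∀ n (v : Vertex (suc n) q) t → ∃ λ X → π (suc n) X ≡ v × σ (suc n) X ≡ t
  onto n (a ∷ vs) t with π-onto n vs
  ... | Z , πZ≡vs with local-onto a (t ⊖ σ n Z)
  ...   | Y , φY≡a , ψY≡t⊖σZ = Y ++ Z , trans (π-++ n Y Z) (cong₂ _∷_ φY≡a πZ≡vs) ,
          trans (σ-++ n Y Z) (trans (cong (_⊕ σ n Z) ψY≡t⊖σZ) (⊖-⊕ t (σ n Z)))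

block : ∀ k r → Fin (k * r) → Fin k
block k r i = proj₁ (remQuot {k} r i)

offset : ∀ k r → Fin (k * r) → Fin r
offset k r i = proj₂ (remQuot {k} r i)

combine-block-offset : ∀ k r (i : Fin (k * r)) → combine (block k r i) (offset k r i) ≡ i
combine-block-offset k r i = Finₚ.combine-remQuot {k} r i

block-combine : ∀ {k r} (i : Fin k) (t : Fin r) → block k r (combine i t) ≡ i
block-combine i t = cong proj₁ (Finₚ.remQuot-combine i t)

combine-== : ∀ {k r} (i' i : Fin k) (t' t : Fin r) → (combine i' t' == combine i t) ≡ (i' == i ∧ t' == t)
combine-== i' i t' t with i' ≟ i | t' ≟ t
... | yes refl | yes refl = ==-refl (combine i' t')
... | yes _    | no t'≢t  = ==-false (λ eq → t'≢t (proj₂ (Finₚ.combine-injective i' t' i t eq)))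
... | no i'≢i  | _        = ==-false (λ eq → i'≢i (proj₁ (Finₚ.combine-injective i' t' i t eq)))

lift-perfect : ∀ {m n q k r} {π : Vertex m q → Vertex n q} {σ : Vertex m q → Fin r}
                 {f : Vertex n q → Fin k} {S : Fin k → Fin k → ℕ}
  → IsCovering π σ → (∀ v t → ∃ λ X → π X ≡ v × σ X ≡ t)
  → IsPerfectColoring n q k f S
  → IsPerfectColoring m q (k * r) (λ X → combine (f (π X)) (σ X)) (λ i j → S (block k r i) (block k r j))
lift-perfect {m} {_} {q} {k} {r} {π} {σ} {f} {S} covers onto (onto-f , regular-f) = onto-g , regular-g
  where
  open ≡-Reasoning
  g : Vertex m q → Fin (k * r)
  g X = combine (f (π X)) (σ X)

  onto-g : ∀ j → ∃ λ X → g X ≡ j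
  onto-g j with onto-f (block k r j)
  ... | v , fv≡i with onto v (offset k r j)
  ...   | X , πX≡v , σX≡t = X , (begin
    combine (f (π X)) (σ X)              ≡⟨ cong₂ combine (trans (cong f πX≡v) fv≡i) σX≡t ⟩
    combine (block k r j) (offset k r j) ≡⟨ combine-block-offset k r j ⟩
    j                                    ∎)

  -- Neighbours of colour (i,t) correspond, via the covering, to neighbours of
  -- π X of colour i under f.
  regular-combine : ∀ X i t → nbrCount g X (combine i t) ≡ S (f (π X)) i
  regular-combine X i t = begin
    nbrCount g X (combine i t)                               ≡⟨ nbrCount≡nbrSum g X (combine i t) ⟩
    nbrSum X (λ W → ind (g W == combine i t))
      ≡⟨ nbrSum-cong X (λ W → trans (cong ind (combine-== (f (π W)) i (σ W) t)) (ind-∧-* (f (π W) == i) (σ W == t))) ⟩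
    nbrSum X (λ W → ind (f (π W) == i) * ind (σ W == t))     ≡⟨ covers X (λ w → ind (f w == i)) t ⟩
    nbrSum (π X) (λ w → ind (f w == i))                      ≡⟨ nbrCount≡nbrSum f (π X) i ⟨
    nbrCount f (π X) i                                       ≡⟨ regular-f (π X) i ⟩
    S (f (π X)) i                                            ∎

  regular-g : ∀ X j → nbrCount g X j ≡ S (block k r (g X)) (block k r j)
  regular-g X j = begin
    nbrCount g X j                                   ≡⟨ cong (nbrCount g X) (combine-block-offset k r j) ⟨
    nbrCount g X (combine (block k r j) (offset k r j))  ≡⟨ regular-combine X (block k r j) (offset k r j) ⟩
    S (f (π X)) (block k r j)
      ≡⟨ cong (λ i → S i (block k r j)) (block-combine (f (π X)) (σ X)) ⟨
    S (block k r (g X)) (block k r j)                    ∎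

perfect-resp : ∀ {m q k} {g : Vertex m q → Fin k} {S S' : Fin k → Fin k → ℕ}
  → (∀ i j → S i j ≡ S' i j) → IsPerfectColoring m q k g S → IsPerfectColoring m q k g S'
perfect-resp {g = g} S≗S' (onto , regular) = onto , λ v j → trans (regular v j) (S≗S' (g v) j)

resize : ∀ {m m' q k} {S : Fin k → Fin k → ℕ} → m ≡ m'
  → Σ (Vertex m q → Fin k) (λ g → IsPerfectColoring m q k g S)
  → Σ (Vertex m' q → Fin k) (λ g → IsPerfectColoring m' q k g S)
resize refl coloring = coloring

first-block : ∀ {q} (t : Fin q) → (toℕ (combine {2} zero t) <ᵇ q) ≡ true
first-block {q} t rewrite Finₚ.toℕ-combine {2} {q} zero t | *-zeroʳ q =
  Equivalence.to Boolₚ.T-≡ (<⇒<ᵇ (Finₚ.toℕ<n t))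

+-≮ᵇ : ∀ m n → (m + n <ᵇ m) ≡ false
+-≮ᵇ zero    n = refl
+-≮ᵇ (suc m) n = +-≮ᵇ m n

second-block : ∀ {q} (t : Fin q) → (toℕ (combine {2} (suc zero) t) <ᵇ q) ≡ false
second-block {q} t rewrite Finₚ.toℕ-combine {2} {q} (suc zero) t | *-identityʳ q = +-≮ᵇ q (toℕ t)

blockT-combine : ∀ q a b c d (i j : Fin 2) (s t : Fin q) →
  blockT q a b c d (combine i s) (combine j t) ≡ mat2 a b c d i j
blockT-combine q a b c d zero       zero       s t rewrite first-block s  | first-block t  = refl
blockT-combine q a b c d zero       (suc zero) s t rewrite first-block s  | second-block t = refl
blockT-combine q a b c d (suc zero) zero       s t rewrite second-block s | first-block t  = refl
blockT-combine q a b c d (suc zero) (suc zero) s t rewrite second-block s | second-block t = refl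

blockT-blowup : ∀ q a b c d (i j : Fin (2 * q)) → mat2 a b c d (block 2 q i) (block 2 q j) ≡ blockT q a b c d i j
blockT-blowup q a b c d i j = trans
  (sym (blockT-combine q a b c d (block 2 q i) (block 2 q j) (offset 2 q i) (offset 2 q j)))
  (cong₂ (blockT q a b c d) (combine-block-offset 2 q i) (combine-block-offset 2 q j))

no-onto-2-colouring : ∀ {n q} (f : Vertex n q → Fin 2)
  → (∀ (v w : Vertex n q) → v ≡ w) → ¬ (∀ j → ∃ λ v → f v ≡ j)
no-onto-2-colouring f all-equal onto with onto zero | onto (suc zero)
... | v , fv≡0 | w , fw≡1 with trans (sym fv≡0) (trans (cong f (all-equal v w)) fw≡1)
...   | ()

H₀-trivial : ∀ {q} (v w : Vertex 0 q) → v ≡ w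
H₀-trivial [] [] = refl

empty-alphabet : ∀ {n} (v w : Vertex (suc n) 0) → v ≡ w
empty-alphabet (() ∷ _) _

unary-alphabet : ∀ {n} (v w : Vertex n 1) → v ≡ w
unary-alphabet []         []         = refl
unary-alphabet (zero ∷ v) (zero ∷ w) = cong (zero ∷_) (unary-alphabet v w)

-- For q ≥ 2 and n ≥ 1 the code gives a local covering of H(q,q), hence a
-- surjective covering H((n+1)q,q) → H(n+1,q) × Z_q, along which f lifts.
lemma8 : (n q : ℕ) (a b c d : ℕ) (f : Vertex n q → Fin 2)
    → IsPerfectColoring n q 2 f (mat2 a b c d)
    → OnePerfectCodeExists (suc q) q
    → Σ (Vertex (q * n) q → Fin (2 * q)) λ g
        → IsPerfectColoring (q * n) q (2 * q) g (blockT q a b c d)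
lemma8 zero    q             a b c d f perfect-f _ = ⊥-elim (no-onto-2-colouring f H₀-trivial (proj₁ perfect-f))
lemma8 (suc n) zero          a b c d f perfect-f _ = ⊥-elim (no-onto-2-colouring f empty-alphabet (proj₁ perfect-f))
lemma8 (suc n) (suc zero)    a b c d f perfect-f _ = ⊥-elim (no-onto-2-colouring f unary-alphabet (proj₁ perfect-f))
lemma8 (suc n) q@(suc (suc p)) a b c d f perfect-f (C , perfect-C) =
  resize {S = blockT q a b c d} (*-comm (suc n) q) (g , perfect-resp (blockT-blowup q a b c d) lifted)
  where
  open PerfectCode (suc p) C perfect-C using (φ; ψ; local-covering)
  open Blockwise p φ ψ local-covering using (π; σ; covering; onto)
  g : Vertex (suc n * q) q → Fin (2 * q)
  g X = combine (f (π (suc n) X)) (σ (suc n) X)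
  lifted : IsPerfectColoring (suc n * q) q (2 * q) g (λ i j → mat2 a b c d (block 2 q i) (block 2 q j))
  lifted = lift-perfect {S = mat2 a b c d} (covering (suc n)) (onto n) perfect-f
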